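{- Let $S_1$ and $S_2$ be finite sets and let $\varphi_1\colon 2^{S_1}\to\mathbb{R}_+$ and $\varphi_2\colon 2^{S_2}\to\mathbb{R}_+$ be submodular functions with $\varphi_1(\emptyset)=0$ and $\varphi_2(\emptyset)=0$. Let $\mu_1\colon S_1\to\mathbb{R}_+$ and $\mu_2\colon S_2\to\mathbb{R}_+$ satisfy $\mu_1(S_1)=\varphi_1(S_1)$ and $\mu_2(S_2)=\varphi_2(S_2)$, where $\mu_i(X)=\sum_{x\in X}\mu_i(x)$. Define $b\colon 2^{S_1\times S_2}\to\mathbb{R}$ by \[ b(Z)=\sum_{e_1\in S_1}\mu_1(e_1)\,\varphi_2\bigl(\{y\in S_2 : (e_1,y)\in Z\}\bigr)+\sum_{e_2\in S_2}\mu_2(e_2)\,\varphi_1\bigl(\{x\in S_1 : (x,e_2)\in Z\}\bigr)-\sum_{(e_1,e_2)\in Z}\mu_1(e_1)\mu_2(e_2). \] Then $b$ is a submodular coupling of $\varphi_1$ and $\varphi_2$.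
   Context: A set function $\varphi$ on $2^S$ is submodular if $\varphi(X)+\varphi(Y)\ge\varphi(X\cap Y)+\varphi(X\cup Y)$ for all $X,Y\subseteq S$. A function $\varphi\colon 2^{S_1\times S_2}\to\mathbb{R}$ is a coupling of $\varphi_1\colon 2^{S_1}\to\mathbb{R}$ and $\varphi_2\colon 2^{S_2}\to\mathbb{R}$ if $\varphi(X_1\times S_2)=\varphi_1(X_1)\cdot\varphi_2(S_2)$ for every $X_1\subseteq S_1$ and $\varphi(S_1\times X_2)=\varphi_1(S_1)\cdot\varphi_2(X_2)$ for every $X_2\subseteq S_2$. -}

module Defs where

open import Level using (Level; _⊔_) renaming (suc to lsuc)
open import Data.Nat using (ℕ; zero; suc)
open import Data.Fin using (Fin; zero; suc)
open import Data.Bool using (Bool; true; false; if_then_else_)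
open import Data.Vec using (Vec; lookup; map; zipWith; tabulate)
open import Data.Fin.Subset using (Subset; _∩_; _∪_; ⊥; ⊤)
open import Data.Product using (_×_)
open import Algebra.Bundles using (CommutativeRing)
open import Relation.Binary.Core using (Rel)
open import Relation.Binary.Structures using (IsTotalOrder)

-- A totally ordered commutative ring (the real numbers ℝ are an instance).
-- The stdlib has no reals; the theorem is stated for every such ring.
record OrderedCommutativeRing (c ℓ₁ ℓ₂ : Level) : Set (lsuc (c ⊔ ℓ₁ ⊔ ℓ₂)) where
  field
    commutativeRing : CommutativeRing c ℓ₁
  open CommutativeRing commutativeRing public
  field
    _≤_          : Rel Carrier ℓ₂
    isTotalOrder : IsTotalOrder _≈_ _≤_
    +-monoˡ-≤    : ∀ z {x y} → x ≤ y → (x + z) ≤ (y + z)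
    *-nonneg     : ∀ {x y} → 0# ≤ x → 0# ≤ y → 0# ≤ (x * y)

-- Subsets of S₁ × S₂ with S₁ = Fin n₁, S₂ = Fin n₂: an n₁ × n₂ Boolean matrix;
-- Z[e₁][e₂] = true  iff  (e₁ , e₂) ∈ Z.
Subset₂ : ℕ → ℕ → Set
Subset₂ n₁ n₂ = Vec (Subset n₂) n₁

_∩₂_ : ∀ {n₁ n₂} → Subset₂ n₁ n₂ → Subset₂ n₁ n₂ → Subset₂ n₁ n₂
Z ∩₂ W = zipWith _∩_ Z W

_∪₂_ : ∀ {n₁ n₂} → Subset₂ n₁ n₂ → Subset₂ n₁ n₂ → Subset₂ n₁ n₂
Z ∪₂ W = zipWith _∪_ Z W

_×S₂ : ∀ {n₁ n₂} → Subset n₁ → Subset₂ n₁ n₂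
X₁ ×S₂ = map (λ b → if b then ⊤ else ⊥) X₁

S₁×_ : ∀ {n₁ n₂} → Subset n₂ → Subset₂ n₁ n₂
S₁× X₂ = tabulate (λ _ → X₂)

row : ∀ {n₁ n₂} → Subset₂ n₁ n₂ → Fin n₁ → Subset n₂
row Z e₁ = lookup Z e₁

col : ∀ {n₁ n₂} → Subset₂ n₁ n₂ → Fin n₂ → Subset n₁
col Z e₂ = map (λ r → lookup r e₂) Z

module _ {c ℓ₁ ℓ₂} (R : OrderedCommutativeRing c ℓ₁ ℓ₂) where
  open OrderedCommutativeRing R hiding (zero)

  Σ[_] : (n : ℕ) → (Fin n → Carrier) → Carrier
  Σ[ zero ]  f = 0#
  Σ[ suc n ] f = f zero + Σ[ n ] (λ i → f (suc i))

  measure : ∀ {n} → (Fin n → Carrier) → Subset n → Carrier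
  measure {n} μ X = Σ[ n ] (λ x → if lookup X x then μ x else 0#)

  Nonneg : ∀ {A : Set} → (A → Carrier) → Set ℓ₂
  Nonneg f = ∀ a → 0# ≤ f a

  Submodular : ∀ {n} → (Subset n → Carrier) → Set (ℓ₂)
  Submodular φ = ∀ X Y → (φ (X ∩ Y) + φ (X ∪ Y)) ≤ (φ X + φ Y)

  Submodular₂ : ∀ {n₁ n₂} → (Subset₂ n₁ n₂ → Carrier) → Set ℓ₂
  Submodular₂ φ = ∀ X Y → (φ (X ∩₂ Y) + φ (X ∪₂ Y)) ≤ (φ X + φ Y)

  IsCoupling : ∀ {n₁ n₂} → (Subset₂ n₁ n₂ → Carrier)
             → (Subset n₁ → Carrier) → (Subset n₂ → Carrier) → Set (ℓ₁)
  IsCoupling {n₁} {n₂} φ φ₁ φ₂ =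
    (∀ (X₁ : Subset n₁) → φ (_×S₂ {n₂ = n₂} X₁) ≈ (φ₁ X₁ * φ₂ ⊤))
    × (∀ (X₂ : Subset n₂) → φ (S₁×_ {n₁ = n₁} X₂) ≈ (φ₁ ⊤ * φ₂ X₂))

  b : ∀ {n₁ n₂} → (Subset n₁ → Carrier) → (Subset n₂ → Carrier)
    → (Fin n₁ → Carrier) → (Fin n₂ → Carrier) → Subset₂ n₁ n₂ → Carrier
  b {n₁} {n₂} φ₁ φ₂ μ₁ μ₂ Z =
    (Σ[ n₁ ] (λ e₁ → μ₁ e₁ * φ₂ (row Z e₁))
     + Σ[ n₂ ] (λ e₂ → μ₂ e₂ * φ₁ (col Z e₂)))
    - Σ[ n₁ ] (λ e₁ → Σ[ n₂ ] (λ e₂ →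
        if lookup (lookup Z e₁) e₂ then μ₁ e₁ * μ₂ e₂ else 0#))

-- Write b = P₂ + P₁ − M, where P₂ Z = Σ_{e₁} μ₁(e₁) φ₂(row e₁ of Z),
-- P₁ Z = Σ_{e₂} μ₂(e₂) φ₁(column e₂ of Z), and M = μ₁ ⊗ μ₂ is the product
-- measure. Taking a row, a column or an entry of Z commutes with ∩ and ∪,
-- so P₁ and P₂ are nonnegative combinations of submodular functions and M
-- is modular; hence b is submodular. On a rectangle X₁ × X₂ the three
-- parts are μ₁(X₁)φ₂(X₂), μ₂(X₂)φ₁(X₁) and μ₁(X₁)μ₂(X₂) (this uses
-- φᵢ(∅) = 0), so for X₂ = S₂ the identity μ₂(S₂) = φ₂(S₂) makes the first
-- and last parts cancel, leaving φ₁(X₁)φ₂(S₂); symmetrically for X₁ = S₁.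
module Submission where

open import Defs
open import Level using (Level)
open import Algebra.Core using (Op₂)
open import Data.Nat using (ℕ; zero; suc)
open import Data.Fin as Fin using (Fin)
open import Data.Fin.Subset using (Subset; ⊥; ⊤)
open import Data.Product using (_×_; _,_)
open import Data.Bool using (Bool; true; false; _∧_; _∨_; if_then_else_)
open import Data.Vec using ([]; _∷_; lookup; map; zipWith)
open import Data.Vec.Properties using (lookup-zipWith; lookup-map; lookup-replicate)
import Algebra.Morphism.Definitions as MorphismDefinitions
open import Relation.Binary.PropositionalEquality as ≡ using (_≡_)
open import Relation.Binary.Bundles using (Poset)
open import Relation.Binary.Structures using (IsTotalOrder)
import Relation.Binary.Reasoning.PartialOrder as PosetReasoning

module _ {L L′ : Set} where
  open MorphismDefinitions L L′ _≡_ public using (Homomorphic₂)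

guardSet : ∀ {n} → Bool → Subset n → Subset n
guardSet x X = if x then X else ⊥

-- The rectangle X₁ × X₂, written so that X₁ ⊠ ⊤ is literally X₁ ×S₂.
_⊠_ : ∀ {n₁ n₂} → Subset n₁ → Subset n₂ → Subset₂ n₁ n₂
X₁ ⊠ X₂ = map (λ x → guardSet x X₂) X₁

entry : ∀ {n₁ n₂} → Subset₂ n₁ n₂ → Fin n₁ → Fin n₂ → Bool
entry Z e₁ e₂ = lookup (row Z e₁) e₂

module _ {n₁ n₂ : ℕ} (f : Bool → Bool → Bool) where

  row-homo : (e₁ : Fin n₁) →
             Homomorphic₂ (λ (Z : Subset₂ n₁ n₂) → row Z e₁) (zipWith (zipWith f)) (zipWith f)
  row-homo e₁ = lookup-zipWith (zipWith f) e₁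

  entry-homo : (e₁ : Fin n₁) (e₂ : Fin n₂) →
               Homomorphic₂ (λ (Z : Subset₂ n₁ n₂) → entry Z e₁ e₂) (zipWith (zipWith f)) f
  entry-homo e₁ e₂ Z W = ≡.trans (≡.cong (λ r → lookup r e₂) (row-homo e₁ Z W))
                                 (lookup-zipWith f e₂ (row Z e₁) (row W e₁))

col-homo : ∀ {n₁ n₂} (f : Bool → Bool → Bool) (e₂ : Fin n₂) →
           Homomorphic₂ (λ (Z : Subset₂ n₁ n₂) → col Z e₂) (zipWith (zipWith f)) (zipWith f)
col-homo f e₂ []      []      = ≡.refl
col-homo f e₂ (z ∷ Z) (w ∷ W) =
  ≡.cong₂ _∷_ (lookup-zipWith f e₂ z w) (col-homo f e₂ Z W)

lookup-guardSet : ∀ {n} x (X : Subset n) e → lookup (guardSet x X) e ≡ x ∧ lookup X e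
lookup-guardSet true  X e = ≡.refl
lookup-guardSet false X e = lookup-replicate e false

∷-guardSet : ∀ {n} x y (X : Subset n) → (x ∧ y) ∷ guardSet y X ≡ guardSet y (x ∷ X)
∷-guardSet true  true  X = ≡.refl
∷-guardSet false true  X = ≡.refl
∷-guardSet true  false X = ≡.refl
∷-guardSet false false X = ≡.refl

module _ {n₂ : ℕ} where

  row-⊠ : ∀ {n₁} (X₁ : Subset n₁) (X₂ : Subset n₂) e₁ →
          row (X₁ ⊠ X₂) e₁ ≡ guardSet (lookup X₁ e₁) X₂
  row-⊠ X₁ X₂ e₁ = lookup-map e₁ _ X₁

  col-⊠ : ∀ {n₁} (X₁ : Subset n₁) (X₂ : Subset n₂) e₂ →
          col (X₁ ⊠ X₂) e₂ ≡ guardSet (lookup X₂ e₂) X₁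
  col-⊠ [] X₂ e₂ with lookup X₂ e₂
  ... | true  = ≡.refl
  ... | false = ≡.refl
  col-⊠ (x ∷ X₁) X₂ e₂ = begin
    lookup (guardSet x X₂) e₂ ∷ col (X₁ ⊠ X₂) e₂
      ≡⟨ ≡.cong₂ _∷_ (lookup-guardSet x X₂ e₂) (col-⊠ X₁ X₂ e₂) ⟩
    (x ∧ lookup X₂ e₂) ∷ guardSet (lookup X₂ e₂) X₁
      ≡⟨ ∷-guardSet x (lookup X₂ e₂) X₁ ⟩
    guardSet (lookup X₂ e₂) (x ∷ X₁) ∎
    where open ≡.≡-Reasoning

  entry-⊠ : ∀ {n₁} (X₁ : Subset n₁) (X₂ : Subset n₂) e₁ e₂ →
            entry (X₁ ⊠ X₂) e₁ e₂ ≡ lookup X₁ e₁ ∧ lookup X₂ e₂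
  entry-⊠ X₁ X₂ e₁ e₂ = ≡.trans (≡.cong (λ r → lookup r e₂) (row-⊠ X₁ X₂ e₁))
                                (lookup-guardSet (lookup X₁ e₁) X₂ e₂)

  S₁×-⊠ : ∀ n₁ (X₂ : Subset n₂) → S₁×_ {n₁ = n₁} X₂ ≡ ⊤ ⊠ X₂
  S₁×-⊠ zero    X₂ = ≡.refl
  S₁×-⊠ (suc n) X₂ = ≡.cong (X₂ ∷_) (S₁×-⊠ n X₂)

module OrderedRingProperties {c ℓ₁ ℓ₂} (R : OrderedCommutativeRing c ℓ₁ ℓ₂) where

  open OrderedCommutativeRing R public hiding (zero; _≤_)
  open import Algebra.Properties.AbelianGroup +-abelianGroup public
    using (xyx⁻¹≈y; ⁻¹-∙-comm; //-rightDividesˡ; //-rightDividesʳ)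
  open import Algebra.Properties.CommutativeSemigroup +-commutativeSemigroup public
    using (interchange)
  open import Algebra.Properties.Semiring.Sum semiring
    using (sum; sum-cong-≋; ∑-distrib-+; *-distribˡ-sum; *-distribʳ-sum)

  infix 4 _≤_
  _≤_ : Carrier → Carrier → Set ℓ₂
  _≤_ = OrderedCommutativeRing._≤_ R

  poset : Poset c ℓ₁ ℓ₂
  poset = record { isPartialOrder = IsTotalOrder.isPartialOrder isTotalOrder }

  open PosetReasoning poset public

  +-mono-≤ : ∀ {x y u v} → x ≤ y → u ≤ v → x + u ≤ y + v
  +-mono-≤ {x} {y} {u} {v} x≤y u≤v = begin
    x + u ≤⟨ +-monoˡ-≤ u x≤y ⟩
    y + u ≈⟨ +-comm y u ⟩
    u + y ≤⟨ +-monoˡ-≤ y u≤v ⟩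
    v + y ≈⟨ +-comm v y ⟩
    y + v ∎

  x≤y⇒0≤y-x : ∀ {x y} → x ≤ y → 0# ≤ y - x
  x≤y⇒0≤y-x {x} {y} x≤y = begin
    0#    ≈⟨ -‿inverseʳ x ⟨
    x - x ≤⟨ +-monoˡ-≤ (- x) x≤y ⟩
    y - x ∎

  *-monoˡ-≤-nonneg : ∀ {k x y} → 0# ≤ k → x ≤ y → k * x ≤ k * y
  *-monoˡ-≤-nonneg {k} {x} {y} 0≤k x≤y = begin
    k * x                ≈⟨ +-identityˡ (k * x) ⟨
    0# + k * x           ≤⟨ +-monoˡ-≤ (k * x) (*-nonneg 0≤k (x≤y⇒0≤y-x x≤y)) ⟩
    k * (y - x) + k * x  ≈⟨ distribˡ k (y - x) x ⟨
    k * ((y - x) + x)    ≈⟨ *-congˡ (//-rightDividesˡ x y) ⟩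
    k * y                ∎

  guard : Bool → Carrier → Carrier
  guard x v = if x then v else 0#

  guard-∧-* : ∀ x y u v → guard (x ∧ y) (u * v) ≈ guard x u * guard y v
  guard-∧-* true  true  u v = refl
  guard-∧-* true  false u v = sym (zeroʳ u)
  guard-∧-* false y     u v = sym (zeroˡ (guard y v))

  Σ≈sum : ∀ n (f : Fin n → Carrier) → Σ[ R ] n f ≈ sum f
  Σ≈sum zero    f = refl
  Σ≈sum (suc n) f = +-congˡ (Σ≈sum n (λ i → f (Fin.suc i)))

  Σ-cong : ∀ n {f g : Fin n → Carrier} → (∀ i → f i ≈ g i) → Σ[ R ] n f ≈ Σ[ R ] n g
  Σ-cong n {f} {g} f≈g = begin-equality
    Σ[ R ] n f ≈⟨ Σ≈sum n f ⟩
    sum f      ≈⟨ sum-cong-≋ f≈g ⟩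
    sum g      ≈⟨ Σ≈sum n g ⟨
    Σ[ R ] n g ∎

  Σ-mono-≤ : ∀ n {f g : Fin n → Carrier} → (∀ i → f i ≤ g i) → Σ[ R ] n f ≤ Σ[ R ] n g
  Σ-mono-≤ zero    f≤g = IsTotalOrder.refl isTotalOrder
  Σ-mono-≤ (suc n) f≤g = +-mono-≤ (f≤g Fin.zero) (Σ-mono-≤ n (λ i → f≤g (Fin.suc i)))

  Σ-distrib-+ : ∀ n (f g : Fin n → Carrier) →
                Σ[ R ] n (λ i → f i + g i) ≈ Σ[ R ] n f + Σ[ R ] n g
  Σ-distrib-+ n f g = begin-equality
    Σ[ R ] n (λ i → f i + g i) ≈⟨ Σ≈sum n _ ⟩
    sum (λ i → f i + g i)      ≈⟨ ∑-distrib-+ f g ⟩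
    sum f + sum g              ≈⟨ +-cong (Σ≈sum n f) (Σ≈sum n g) ⟨
    Σ[ R ] n f + Σ[ R ] n g    ∎

  Σ-*ʳ : ∀ n x (f : Fin n → Carrier) → Σ[ R ] n (λ i → f i * x) ≈ Σ[ R ] n f * x
  Σ-*ʳ n x f = begin-equality
    Σ[ R ] n (λ i → f i * x) ≈⟨ Σ≈sum n _ ⟩
    sum (λ i → f i * x)      ≈⟨ *-distribʳ-sum x f ⟨
    sum f * x                ≈⟨ *-congʳ (Σ≈sum n f) ⟨
    Σ[ R ] n f * x           ∎

  Σ-*ˡ : ∀ n x (f : Fin n → Carrier) → Σ[ R ] n (λ i → x * f i) ≈ x * Σ[ R ] n f
  Σ-*ˡ n x f = begin-equality
    Σ[ R ] n (λ i → x * f i) ≈⟨ Σ≈sum n _ ⟩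
    sum (λ i → x * f i)      ≈⟨ *-distribˡ-sum x f ⟨
    x * sum f                ≈⟨ *-congˡ (Σ≈sum n f) ⟨
    x * Σ[ R ] n f           ∎

  Σ-Σ-* : ∀ m n (f : Fin m → Carrier) (g : Fin n → Carrier) →
          Σ[ R ] m (λ i → Σ[ R ] n (λ j → f i * g j)) ≈ Σ[ R ] m f * Σ[ R ] n g
  Σ-Σ-* m n f g = trans (Σ-cong m (λ i → Σ-*ˡ n (f i) g)) (Σ-*ʳ m (Σ[ R ] n g) f)

module SubmodularFunctions {c ℓ₁ ℓ₂} (R : OrderedCommutativeRing c ℓ₁ ℓ₂) where

  open OrderedRingProperties R

  SubmodularOn : {L : Set} → Op₂ L → Op₂ L → (L → Carrier) → Set ℓ₂
  SubmodularOn _⊓_ _⊔_ f = ∀ X Y → f (X ⊓ Y) + f (X ⊔ Y) ≤ f X + f Y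

  ModularOn : {L : Set} → Op₂ L → Op₂ L → (L → Carrier) → Set ℓ₁
  ModularOn _⊓_ _⊔_ f = ∀ X Y → f (X ⊓ Y) + f (X ⊔ Y) ≈ f X + f Y

  module Closure {L : Set} (_⊓_ _⊔_ : Op₂ L) where

    submodular-+ : ∀ {f g} → SubmodularOn _⊓_ _⊔_ f → SubmodularOn _⊓_ _⊔_ g →
                   SubmodularOn _⊓_ _⊔_ (λ X → f X + g X)
    submodular-+ {f} {g} f-sub g-sub X Y = begin
      (f (X ⊓ Y) + g (X ⊓ Y)) + (f (X ⊔ Y) + g (X ⊔ Y))
        ≈⟨ interchange _ _ _ _ ⟩
      (f (X ⊓ Y) + f (X ⊔ Y)) + (g (X ⊓ Y) + g (X ⊔ Y))
        ≤⟨ +-mono-≤ (f-sub X Y) (g-sub X Y) ⟩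
      (f X + f Y) + (g X + g Y)
        ≈⟨ interchange _ _ _ _ ⟩
      (f X + g X) + (f Y + g Y) ∎

    submodular-minus-modular : ∀ {f g} → SubmodularOn _⊓_ _⊔_ f → ModularOn _⊓_ _⊔_ g →
                               SubmodularOn _⊓_ _⊔_ (λ X → f X - g X)
    submodular-minus-modular {f} {g} f-sub g-mod X Y = begin
      (f (X ⊓ Y) - g (X ⊓ Y)) + (f (X ⊔ Y) - g (X ⊔ Y))
        ≈⟨ interchange _ _ _ _ ⟩
      (f (X ⊓ Y) + f (X ⊔ Y)) + (- g (X ⊓ Y) - g (X ⊔ Y))
        ≈⟨ +-congˡ (⁻¹-∙-comm _ _) ⟩
      (f (X ⊓ Y) + f (X ⊔ Y)) - (g (X ⊓ Y) + g (X ⊔ Y))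
        ≤⟨ +-monoˡ-≤ _ (f-sub X Y) ⟩
      (f X + f Y) - (g (X ⊓ Y) + g (X ⊔ Y))
        ≈⟨ +-congˡ (-‿cong (g-mod X Y)) ⟩
      (f X + f Y) - (g X + g Y)
        ≈⟨ +-congˡ (⁻¹-∙-comm _ _) ⟨
      (f X + f Y) + (- g X - g Y)
        ≈⟨ interchange _ _ _ _ ⟩
      (f X - g X) + (f Y - g Y) ∎

    submodular-*-nonneg : ∀ {k f} → 0# ≤ k → SubmodularOn _⊓_ _⊔_ f →
                          SubmodularOn _⊓_ _⊔_ (λ X → k * f X)
    submodular-*-nonneg {k} {f} 0≤k f-sub X Y = begin
      k * f (X ⊓ Y) + k * f (X ⊔ Y) ≈⟨ distribˡ k _ _ ⟨
      k * (f (X ⊓ Y) + f (X ⊔ Y))   ≤⟨ *-monoˡ-≤-nonneg 0≤k (f-sub X Y) ⟩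
      k * (f X + f Y)               ≈⟨ distribˡ k _ _ ⟩
      k * f X + k * f Y             ∎

    submodular-Σ : ∀ n {f : Fin n → L → Carrier} → (∀ i → SubmodularOn _⊓_ _⊔_ (f i)) →
                   SubmodularOn _⊓_ _⊔_ (λ X → Σ[ R ] n (λ i → f i X))
    submodular-Σ n {f} f-sub X Y = begin
      Σ[ R ] n (λ i → f i (X ⊓ Y)) + Σ[ R ] n (λ i → f i (X ⊔ Y))
        ≈⟨ Σ-distrib-+ n _ _ ⟨
      Σ[ R ] n (λ i → f i (X ⊓ Y) + f i (X ⊔ Y))
        ≤⟨ Σ-mono-≤ n (λ i → f-sub i X Y) ⟩
      Σ[ R ] n (λ i → f i X + f i Y)
        ≈⟨ Σ-distrib-+ n _ _ ⟩
      Σ[ R ] n (λ i → f i X) + Σ[ R ] n (λ i → f i Y) ∎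

    modular-Σ : ∀ n {f : Fin n → L → Carrier} → (∀ i → ModularOn _⊓_ _⊔_ (f i)) →
                ModularOn _⊓_ _⊔_ (λ X → Σ[ R ] n (λ i → f i X))
    modular-Σ n f-mod X Y = trans (sym (Σ-distrib-+ n _ _))
                                  (trans (Σ-cong n (λ i → f-mod i X Y)) (Σ-distrib-+ n _ _))

    module _ {L′ : Set} {_⊓′_ _⊔′_ : Op₂ L′} (h : L → L′)
             (h-⊓ : Homomorphic₂ h _⊓_ _⊓′_) (h-⊔ : Homomorphic₂ h _⊔_ _⊔′_) where

      submodular-∘ : ∀ {f} → SubmodularOn _⊓′_ _⊔′_ f → SubmodularOn _⊓_ _⊔_ (λ X → f (h X))
      submodular-∘ f-sub X Y rewrite h-⊓ X Y | h-⊔ X Y = f-sub (h X) (h Y)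

      modular-∘ : ∀ {f} → ModularOn _⊓′_ _⊔′_ f → ModularOn _⊓_ _⊔_ (λ X → f (h X))
      modular-∘ f-mod X Y rewrite h-⊓ X Y | h-⊔ X Y = f-mod (h X) (h Y)

  guard-modular : ∀ v → ModularOn _∧_ _∨_ (λ x → guard x v)
  guard-modular v true  true  = refl
  guard-modular v true  false = +-comm 0# v
  guard-modular v false y     = refl

module Coupling {c ℓ₁ ℓ₂} (R : OrderedCommutativeRing c ℓ₁ ℓ₂) {n₁ n₂ : ℕ}
  (φ₁ : Subset n₁ → OrderedCommutativeRing.Carrier R)
  (φ₂ : Subset n₂ → OrderedCommutativeRing.Carrier R)
  (μ₁ : Fin n₁ → OrderedCommutativeRing.Carrier R)
  (μ₂ : Fin n₂ → OrderedCommutativeRing.Carrier R) where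

  open OrderedRingProperties R
  open SubmodularFunctions R
  open Closure {L = Subset₂ n₁ n₂} _∩₂_ _∪₂_

  rowPart : Subset₂ n₁ n₂ → Carrier
  rowPart Z = Σ[ R ] n₁ (λ e₁ → μ₁ e₁ * φ₂ (row Z e₁))

  colPart : Subset₂ n₁ n₂ → Carrier
  colPart Z = Σ[ R ] n₂ (λ e₂ → μ₂ e₂ * φ₁ (col Z e₂))

  productMeasure : Subset₂ n₁ n₂ → Carrier
  productMeasure Z = Σ[ R ] n₁ (λ e₁ → Σ[ R ] n₂ (λ e₂ → guard (entry Z e₁ e₂) (μ₁ e₁ * μ₂ e₂)))

  b-submodular : Nonneg R μ₁ → Nonneg R μ₂ → Submodular R φ₁ → Submodular R φ₂ →
                 Submodular₂ R (b R φ₁ φ₂ μ₁ μ₂)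
  b-submodular μ₁≥0 μ₂≥0 φ₁-sub φ₂-sub =
    submodular-minus-modular (submodular-+ rowPart-submodular colPart-submodular)
                             productMeasure-modular
    where
    rowPart-submodular : SubmodularOn _∩₂_ _∪₂_ rowPart
    rowPart-submodular = submodular-Σ n₁ λ e₁ → submodular-*-nonneg (μ₁≥0 e₁)
      (submodular-∘ (λ Z → row Z e₁) (row-homo _∧_ e₁) (row-homo _∨_ e₁) φ₂-sub)

    colPart-submodular : SubmodularOn _∩₂_ _∪₂_ colPart
    colPart-submodular = submodular-Σ n₂ λ e₂ → submodular-*-nonneg (μ₂≥0 e₂)
      (submodular-∘ (λ Z → col Z e₂) (col-homo _∧_ e₂) (col-homo _∨_ e₂) φ₁-sub)

    productMeasure-modular : ModularOn _∩₂_ _∪₂_ productMeasure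
    productMeasure-modular = modular-Σ n₁ λ e₁ → modular-Σ n₂ λ e₂ →
      modular-∘ (λ Z → entry Z e₁ e₂) (entry-homo _∧_ e₁ e₂) (entry-homo _∨_ e₁ e₂)
                (guard-modular (μ₁ e₁ * μ₂ e₂))

  module _ {n m : ℕ} (φ : Subset n → Carrier) (φ⊥≈0 : φ ⊥ ≈ 0#) (μ : Fin m → Carrier) where

    *-guardSet : ∀ x u X → u * φ (guardSet x X) ≈ guard x u * φ X
    *-guardSet true  u X = refl
    *-guardSet false u X = trans (*-congˡ φ⊥≈0) (trans (zeroʳ u) (sym (zeroˡ (φ X))))

    Σ-*-guardSet : ∀ (Y : Subset m) X (S : Fin m → Subset n) → (∀ e → S e ≡ guardSet (lookup Y e) X) →
                   Σ[ R ] m (λ e → μ e * φ (S e)) ≈ measure R μ Y * φ X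
    Σ-*-guardSet Y X S S≡ = trans (Σ-cong m pointwise) (Σ-*ʳ m (φ X) _)
      where
      pointwise : ∀ e → μ e * φ (S e) ≈ guard (lookup Y e) (μ e) * φ X
      pointwise e rewrite S≡ e = *-guardSet (lookup Y e) (μ e) X

  b-⊠ : φ₁ ⊥ ≈ 0# → φ₂ ⊥ ≈ 0# → ∀ X₁ X₂ →
        b R φ₁ φ₂ μ₁ μ₂ (X₁ ⊠ X₂)
          ≈ (measure R μ₁ X₁ * φ₂ X₂ + measure R μ₂ X₂ * φ₁ X₁) - measure R μ₁ X₁ * measure R μ₂ X₂
  b-⊠ φ₁⊥≈0 φ₂⊥≈0 X₁ X₂ = +-cong (+-cong rowPart-⊠ colPart-⊠) (-‿cong productMeasure-⊠)
    where
    rowPart-⊠ : rowPart (X₁ ⊠ X₂) ≈ measure R μ₁ X₁ * φ₂ X₂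
    rowPart-⊠ = Σ-*-guardSet φ₂ φ₂⊥≈0 μ₁ X₁ X₂ _ (row-⊠ X₁ X₂)

    colPart-⊠ : colPart (X₁ ⊠ X₂) ≈ measure R μ₂ X₂ * φ₁ X₁
    colPart-⊠ = Σ-*-guardSet φ₁ φ₁⊥≈0 μ₂ X₂ X₁ _ (col-⊠ X₁ X₂)

    productMeasure-⊠ : productMeasure (X₁ ⊠ X₂) ≈ measure R μ₁ X₁ * measure R μ₂ X₂
    productMeasure-⊠ = trans (Σ-cong n₁ λ e₁ → Σ-cong n₂ λ e₂ → pointwise e₁ e₂) (Σ-Σ-* n₁ n₂ _ _)
      where
      pointwise : ∀ e₁ e₂ → guard (entry (X₁ ⊠ X₂) e₁ e₂) (μ₁ e₁ * μ₂ e₂)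
                            ≈ guard (lookup X₁ e₁) (μ₁ e₁) * guard (lookup X₂ e₂) (μ₂ e₂)
      pointwise e₁ e₂ rewrite entry-⊠ X₁ X₂ e₁ e₂ = guard-∧-* _ _ _ _

  b-coupling : φ₁ ⊥ ≈ 0# → φ₂ ⊥ ≈ 0# → measure R μ₁ ⊤ ≈ φ₁ ⊤ → measure R μ₂ ⊤ ≈ φ₂ ⊤ →
               IsCoupling R (b R φ₁ φ₂ μ₁ μ₂) φ₁ φ₂
  b-coupling φ₁⊥≈0 φ₂⊥≈0 μ₁⊤≈φ₁⊤ μ₂⊤≈φ₂⊤ = left , right
    where
    left : ∀ X₁ → b R φ₁ φ₂ μ₁ μ₂ (X₁ ⊠ ⊤) ≈ φ₁ X₁ * φ₂ ⊤
    left X₁ = begin-equality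
      b R φ₁ φ₂ μ₁ μ₂ (X₁ ⊠ ⊤)
        ≈⟨ b-⊠ φ₁⊥≈0 φ₂⊥≈0 X₁ ⊤ ⟩
      (m₁ * φ₂ ⊤ + measure R μ₂ ⊤ * φ₁ X₁) - m₁ * measure R μ₂ ⊤
        ≈⟨ +-cong (+-congˡ (*-congʳ μ₂⊤≈φ₂⊤)) (-‿cong (*-congˡ μ₂⊤≈φ₂⊤)) ⟩
      (m₁ * φ₂ ⊤ + φ₂ ⊤ * φ₁ X₁) - m₁ * φ₂ ⊤
        ≈⟨ xyx⁻¹≈y (m₁ * φ₂ ⊤) (φ₂ ⊤ * φ₁ X₁) ⟩
      φ₂ ⊤ * φ₁ X₁
        ≈⟨ *-comm (φ₂ ⊤) (φ₁ X₁) ⟩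
      φ₁ X₁ * φ₂ ⊤ ∎
      where m₁ = measure R μ₁ X₁

    right : ∀ X₂ → b R φ₁ φ₂ μ₁ μ₂ (S₁×_ {n₁ = n₁} X₂) ≈ φ₁ ⊤ * φ₂ X₂
    right X₂ rewrite S₁×-⊠ n₁ X₂ = begin-equality
      b R φ₁ φ₂ μ₁ μ₂ (⊤ ⊠ X₂)
        ≈⟨ b-⊠ φ₁⊥≈0 φ₂⊥≈0 ⊤ X₂ ⟩
      (measure R μ₁ ⊤ * φ₂ X₂ + m₂ * φ₁ ⊤) - measure R μ₁ ⊤ * m₂
        ≈⟨ +-cong (+-congʳ (*-congʳ μ₁⊤≈φ₁⊤)) (-‿cong (*-congʳ μ₁⊤≈φ₁⊤)) ⟩
      (φ₁ ⊤ * φ₂ X₂ + m₂ * φ₁ ⊤) - φ₁ ⊤ * m₂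
        ≈⟨ +-congˡ (-‿cong (*-comm (φ₁ ⊤) m₂)) ⟩
      (φ₁ ⊤ * φ₂ X₂ + m₂ * φ₁ ⊤) - m₂ * φ₁ ⊤
        ≈⟨ //-rightDividesʳ (m₂ * φ₁ ⊤) (φ₁ ⊤ * φ₂ X₂) ⟩
      φ₁ ⊤ * φ₂ X₂ ∎
      where m₂ = measure R μ₂ X₂

theorem3p1 : ∀ {c ℓ₁ ℓ₂ : Level} (R : OrderedCommutativeRing c ℓ₁ ℓ₂) (n₁ n₂ : ℕ)
    (φ₁ : Subset n₁ → OrderedCommutativeRing.Carrier R)
    (φ₂ : Subset n₂ → OrderedCommutativeRing.Carrier R)
    (μ₁ : Fin n₁ → OrderedCommutativeRing.Carrier R)
    (μ₂ : Fin n₂ → OrderedCommutativeRing.Carrier R)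
    → Nonneg R φ₁ → Nonneg R φ₂
    → Submodular R φ₁ → Submodular R φ₂
    → OrderedCommutativeRing._≈_ R (φ₁ ⊥) (OrderedCommutativeRing.0# R)
    → OrderedCommutativeRing._≈_ R (φ₂ ⊥) (OrderedCommutativeRing.0# R)
    → Nonneg R μ₁ → Nonneg R μ₂
    → OrderedCommutativeRing._≈_ R (measure R μ₁ ⊤) (φ₁ ⊤)
    → OrderedCommutativeRing._≈_ R (measure R μ₂ ⊤) (φ₂ ⊤)
    → Submodular₂ R (b R φ₁ φ₂ μ₁ μ₂) × IsCoupling R (b R φ₁ φ₂ μ₁ μ₂) φ₁ φ₂
theorem3p1 R n₁ n₂ φ₁ φ₂ μ₁ μ₂ _ _ φ₁-sub φ₂-sub φ₁⊥≈0 φ₂⊥≈0 μ₁≥0 μ₂≥0 μ₁⊤≈φ₁⊤ μ₂⊤≈φ₂⊤ =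
  b-submodular μ₁≥0 μ₂≥0 φ₁-sub φ₂-sub , b-coupling φ₁⊥≈0 φ₂⊥≈0 μ₁⊤≈φ₁⊤ μ₂⊤≈φ₂⊤
  where open Coupling R φ₁ φ₂ μ₁ μ₂
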